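{- Let $\Omega$ be a succession rule and let $F=(f_{nk})_{n,k\geq 1}$ be its ECO matrix, so that $f_{nk}$ is the number of nodes labelled $k$ at level $n-1$ of the generating tree of $\Omega$, with $f_{nk}=0$ for $k>n$. For $n\geq 1$ let $\beta_n(x)=\sum_{k=1}^{n}f_{nk}x^k$ and write $\beta_n(x)=\sum_{k=1}^{n}a_{nk}p_k(x)$ in the Aigner basis. Then for every $n\geq 1$, \[ a_{n1}=\sum_{k=1}^{n}f_{nk}, \] i.e. the first column of $A=(a_{nk})$ equals the sequence of row sums of $F$.
   Context: A succession rule $\Omega$ consists of an axiom $(a)$ and productions $(k)\rightsquigarrow (e_1(k))\cdots(e_k(k))$, where all labels are positive integers. Its generating tree is the rooted labelled tree whose root (level $0$) is labelled $a$ and in which every node labelled $k$ has exactly $k$ children, labelled $e_1(k),\dots,e_k(k)$. Standing assumption: the set of labels is $\{1,2,3,\dots\}$ and the largest label produced by $(k)$ is $(k+1)$, so that the labels at level $n-1$ are at most $n$ and $\deg\beta_n=n$. The Aigner basis is $p_0(x)=1$, $p_n(x)=x(x-1)^{n-1}$ for $n\geq1$. -}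

module Defs where

open import Data.Nat using (ℕ; zero; suc; _≤_; _≟_)
open import Data.Fin using (Fin)
open import Data.List using (List; []; _∷_; concatMap; length; filter)
open import Data.Vec.Functional using (toList)
open import Data.Integer using (ℤ; _+_; _*_; -_; 0ℤ; 1ℤ)
open import Data.Product using (Σ; _×_)
open import Relation.Binary.PropositionalEquality using (_≡_)
open import Relation.Nullary using (yes; no)

record SuccessionRule : Set where
  field
    axiom : ℕ
    prod  : (k : ℕ) → Fin k → ℕ
open SuccessionRule public

-- Standing assumption: labels are positive integers, the largest label
-- produced by (k) is (k+1) (every produced label is ≤ k+1 and k+1 is
-- produced), and labels at level n-1 are at most n (for level 0 this
-- forces the axiom to be 1).
Standing : SuccessionRule → Set
Standing Ω =
  (1 ≤ axiom Ω × axiom Ω ≤ 1)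
  × ((k : ℕ) → (i : Fin k) → 1 ≤ prod Ω k i × prod Ω k i ≤ suc k)
  × ((k : ℕ) → 1 ≤ k → Σ (Fin k) λ i → prod Ω k i ≡ suc k)

level : SuccessionRule → ℕ → List ℕ
level Ω zero    = axiom Ω ∷ []
level Ω (suc n) = concatMap (λ k → toList (prod Ω k)) (level Ω n)

eco : SuccessionRule → ℕ → ℕ → ℕ
eco Ω zero    k = 0
eco Ω (suc m) k = length (filter (λ l → l ≟ k) (level Ω m))

sum1 : ℕ → (ℕ → ℤ) → ℤ
sum1 zero    f = 0ℤ
sum1 (suc n) f = sum1 n f + f (suc n)

sum0 : ℕ → (ℕ → ℤ) → ℤ
sum0 zero    f = f 0
sum0 (suc n) f = sum0 n f + f (suc n)

-- Polynomials in ℤ[x], represented by their coefficient sequences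
-- (coefficient of x^j at position j).

Poly : Set
Poly = ℕ → ℤ

_≈P_ : Poly → Poly → Set
p ≈P q = (j : ℕ) → p j ≡ q j

monomial : ℕ → Poly
monomial k j with j ≟ k
... | yes _ = 1ℤ
... | no  _ = 0ℤ

constP : ℤ → Poly
constP c zero    = c
constP c (suc j) = 0ℤ

_+P_ : Poly → Poly → Poly
(p +P q) j = p j + q j

scale : ℤ → Poly → Poly
scale c p j = c * p j

_*P_ : Poly → Poly → Poly
(p *P q) j = sum0 j (λ i → p i * q (j Data.Nat.∸ i))

X : Poly
X = monomial 1

Xm1 : Poly
Xm1 = X +P constP (- 1ℤ)

powP : Poly → ℕ → Poly
powP p zero    = constP 1ℤ
powP p (suc m) = p *P powP p m

aigner : ℕ → Poly
aigner zero    = constP 1ℤ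
aigner (suc m) = X *P powP Xm1 m

sumP1 : ℕ → (ℕ → Poly) → Poly
sumP1 zero    P = constP 0ℤ
sumP1 (suc n) P = sumP1 n P +P P (suc n)

beta : SuccessionRule → ℕ → Poly
beta Ω n = sumP1 n (λ k → scale (Data.Integer.+_ (eco Ω n k)) (monomial k))

{-# OPTIONS --safe #-}
module Submission where

-- Evaluate at x = 1.  On the one hand β_n(1) = Σₖ f_{nk}.  On the other hand
-- p₁(1) = 1 while p_k(1) = 0 for k ≥ 2, since x − 1 divides p_k; so the value
-- at 1 of the Aigner expansion of β_n is a_{n1}.

open import Defs
open import Data.Nat using (ℕ; zero; suc; _≤_; _<_; _∸_; _≟_; z≤n; s≤s)
open import Data.Nat.Properties using (suc-injective; m≤n⇒m≤1+n; ≤-refl)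
open import Data.Integer using (ℤ; +_; _+_; _*_; -_; _-_; 0ℤ; 1ℤ)
import Data.Integer.Properties as ℤ
open import Algebra.Properties.CommutativeSemigroup ℤ.+-commutativeSemigroup
  using (interchange)
open import Relation.Binary.PropositionalEquality
open import Relation.Nullary using (yes; no; contradiction)

open ≡-Reasoning

sum0-cong : ∀ n {f g : ℕ → ℤ} → (∀ i → f i ≡ g i) → sum0 n f ≡ sum0 n g
sum0-cong zero    f≗g = f≗g 0
sum0-cong (suc n) f≗g = cong₂ _+_ (sum0-cong n f≗g) (f≗g (suc n))

sum0-+ : ∀ n (f g : ℕ → ℤ) → sum0 n (λ i → f i + g i) ≡ sum0 n f + sum0 n g
sum0-+ zero    f g = refl
sum0-+ (suc n) f g = begin
  sum0 n (λ i → f i + g i) + (f (suc n) + g (suc n))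
    ≡⟨ cong (_+ (f (suc n) + g (suc n))) (sum0-+ n f g) ⟩
  (sum0 n f + sum0 n g) + (f (suc n) + g (suc n))
    ≡⟨ interchange (sum0 n f) (sum0 n g) (f (suc n)) (g (suc n)) ⟩
  sum0 (suc n) f + sum0 (suc n) g ∎

sum0-*ˡ : ∀ n c (f : ℕ → ℤ) → sum0 n (λ i → c * f i) ≡ c * sum0 n f
sum0-*ˡ zero    c f = refl
sum0-*ˡ (suc n) c f = begin
  sum0 n (λ i → c * f i) + c * f (suc n) ≡⟨ cong (_+ c * f (suc n)) (sum0-*ˡ n c f) ⟩
  c * sum0 n f + c * f (suc n)           ≡⟨ ℤ.*-distribˡ-+ c (sum0 n f) (f (suc n)) ⟨
  c * sum0 (suc n) f                     ∎

sum0-neg : ∀ n (f : ℕ → ℤ) → sum0 n (λ i → - f i) ≡ - sum0 n f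
sum0-neg zero    f = refl
sum0-neg (suc n) f = begin
  sum0 n (λ i → - f i) + - f (suc n) ≡⟨ cong (_+ - f (suc n)) (sum0-neg n f) ⟩
  - sum0 n f + - f (suc n)           ≡⟨ ℤ.neg-distrib-+ (sum0 n f) (f (suc n)) ⟨
  - sum0 (suc n) f                   ∎

sum0-suc : ∀ n (f : ℕ → ℤ) → sum0 (suc n) f ≡ f 0 + sum0 n (λ i → f (suc i))
sum0-suc zero    f = refl
sum0-suc (suc n) f = begin
  sum0 (suc n) f + f (suc (suc n))
    ≡⟨ cong (_+ f (suc (suc n))) (sum0-suc n f) ⟩
  (f 0 + sum0 n (λ i → f (suc i))) + f (suc (suc n))
    ≡⟨ ℤ.+-assoc (f 0) _ _ ⟩
  f 0 + sum0 (suc n) (λ i → f (suc i)) ∎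

sum0-first-only : ∀ n (f : ℕ → ℤ) → (∀ i → f (suc i) ≡ 0ℤ) → sum0 n f ≡ f 0
sum0-first-only zero    f f≡0 = refl
sum0-first-only (suc n) f f≡0 = begin
  sum0 n f + f (suc n) ≡⟨ cong₂ _+_ (sum0-first-only n f f≡0) (f≡0 n) ⟩
  f 0 + 0ℤ             ≡⟨ ℤ.+-identityʳ (f 0) ⟩
  f 0                  ∎

sum1-cong : ∀ n {f g : ℕ → ℤ} → (∀ {k} → 1 ≤ k → k ≤ n → f k ≡ g k) →
            sum1 n f ≡ sum1 n g
sum1-cong zero    f≗g = refl
sum1-cong (suc n) f≗g =
  cong₂ _+_ (sum1-cong n λ 1≤k k≤n → f≗g 1≤k (m≤n⇒m≤1+n k≤n))
            (f≗g (s≤s z≤n) ≤-refl)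

sum1-first-only : ∀ n (f : ℕ → ℤ) → 1 ≤ n →
                  (∀ {k} → 2 ≤ k → k ≤ n → f k ≡ 0ℤ) → sum1 n f ≡ f 1
sum1-first-only (suc zero)    f _ f≡0 = ℤ.+-identityˡ (f 1)
sum1-first-only (suc (suc n)) f _ f≡0 = begin
  sum1 (suc n) f + f (suc (suc n))
    ≡⟨ cong₂ _+_ (sum1-first-only (suc n) f (s≤s z≤n)
                    λ 2≤k k≤n → f≡0 2≤k (m≤n⇒m≤1+n k≤n))
                 (f≡0 (s≤s (s≤s z≤n)) ≤-refl) ⟩
  f 1 + 0ℤ
    ≡⟨ ℤ.+-identityʳ (f 1) ⟩
  f 1 ∎

shiftP : Poly → Poly
shiftP q zero    = 0ℤ
shiftP q (suc j) = q j

X-*P : ∀ q → (X *P q) ≈P shiftP q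
X-*P q zero    = ℤ.*-zeroˡ (q 0)
X-*P q (suc j) = begin
  sum0 (suc j) (λ i → X i * q (suc j ∸ i))
    ≡⟨ sum0-suc j _ ⟩
  X 0 * q (suc j) + sum0 j (λ i → X (suc i) * q (j ∸ i))
    ≡⟨ cong₂ _+_ (ℤ.*-zeroˡ (q (suc j)))
                 (sum0-first-only j _ λ i → ℤ.*-zeroˡ (q (j ∸ suc i))) ⟩
  0ℤ + 1ℤ * q j
    ≡⟨ trans (ℤ.+-identityˡ _) (ℤ.*-identityˡ (q j)) ⟩
  q j ∎

constP-*P : ∀ c q → (constP c *P q) ≈P scale c q
constP-*P c q j = sum0-first-only j _ λ i → ℤ.*-zeroˡ (q (j ∸ suc i))

Xm1-*P : ∀ q → (Xm1 *P q) ≈P λ j → shiftP q j - q j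
Xm1-*P q j = begin
  sum0 j (λ i → (X i + constP (- 1ℤ) i) * q (j ∸ i))
    ≡⟨ sum0-cong j (λ i → ℤ.*-distribʳ-+ (q (j ∸ i)) (X i) (constP (- 1ℤ) i)) ⟩
  sum0 j (λ i → X i * q (j ∸ i) + constP (- 1ℤ) i * q (j ∸ i))
    ≡⟨ sum0-+ j _ _ ⟩
  (X *P q) j + (constP (- 1ℤ) *P q) j
    ≡⟨ cong₂ _+_ (X-*P q j) (trans (constP-*P (- 1ℤ) q j) (ℤ.-1*i≡-i (q j))) ⟩
  shiftP q j - q j ∎

powP-Xm1-above-degree : ∀ m j → m < j → powP Xm1 m j ≡ 0ℤ
powP-Xm1-above-degree zero    (suc j) _         = refl
powP-Xm1-above-degree (suc m) (suc j) (s≤s m<j) = begin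
  powP Xm1 (suc m) (suc j)
    ≡⟨ Xm1-*P (powP Xm1 m) (suc j) ⟩
  powP Xm1 m j - powP Xm1 m (suc j)
    ≡⟨ cong₂ _-_ (powP-Xm1-above-degree m j m<j)
                 (powP-Xm1-above-degree m (suc j) (m≤n⇒m≤1+n m<j)) ⟩
  0ℤ ∎

monomial-zero : monomial 0 ≈P constP 1ℤ
monomial-zero zero    = refl
monomial-zero (suc j) = refl

monomial-suc : ∀ k → monomial (suc k) ≈P shiftP (monomial k)
monomial-suc k zero = refl
monomial-suc k (suc j) with suc j ≟ suc k | j ≟ k
... | yes _  | yes _  = refl
... | no _   | no _   = refl
... | yes eq | no ne  = contradiction (suc-injective eq) ne
... | no ne  | yes eq = contradiction (cong suc eq) ne

-- A coefficient sequence need not have finite support, so "p(1)" is taken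
-- relative to a degree bound N: it is the sum of the coefficients of x⁰ … x^N.
valueAt1 : ℕ → Poly → ℤ
valueAt1 N p = sum0 N p

valueAt1-constP : ∀ N c → valueAt1 N (constP c) ≡ c
valueAt1-constP zero    c = refl
valueAt1-constP (suc N) c = trans (cong (_+ 0ℤ) (valueAt1-constP N c)) (ℤ.+-identityʳ c)

valueAt1-shiftP : ∀ N q → valueAt1 (suc N) (shiftP q) ≡ valueAt1 N q
valueAt1-shiftP N q = trans (sum0-suc N (shiftP q)) (ℤ.+-identityˡ (valueAt1 N q))

valueAt1-X-*P : ∀ N q → valueAt1 (suc N) (X *P q) ≡ valueAt1 N q
valueAt1-X-*P N q = trans (sum0-cong (suc N) (X-*P q)) (valueAt1-shiftP N q)

-- The sum telescopes; only the top coefficient escapes the truncation.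
valueAt1-Xm1-*P : ∀ N q → valueAt1 (suc N) (Xm1 *P q) ≡ - q (suc N)
valueAt1-Xm1-*P N q = begin
  valueAt1 (suc N) (Xm1 *P q)
    ≡⟨ sum0-cong (suc N) (Xm1-*P q) ⟩
  sum0 (suc N) (λ j → shiftP q j + - q j)
    ≡⟨ sum0-+ (suc N) (shiftP q) (λ j → - q j) ⟩
  valueAt1 (suc N) (shiftP q) + sum0 (suc N) (λ j → - q j)
    ≡⟨ cong₂ _+_ (valueAt1-shiftP N q) (sum0-neg (suc N) q) ⟩
  s + - (s + q (suc N))
    ≡⟨ cong (_+_ s) (ℤ.neg-distrib-+ s (q (suc N))) ⟩
  s + (- s + - q (suc N))
    ≡⟨ ℤ.+-assoc s (- s) (- q (suc N)) ⟨
  (s - s) + - q (suc N)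
    ≡⟨ cong (_+ - q (suc N)) (ℤ.+-inverseʳ s) ⟩
  0ℤ + - q (suc N)
    ≡⟨ ℤ.+-identityˡ (- q (suc N)) ⟩
  - q (suc N) ∎
  where s = valueAt1 N q

valueAt1-monomial : ∀ N k → k ≤ N → valueAt1 N (monomial k) ≡ 1ℤ
valueAt1-monomial N       zero    _         =
  trans (sum0-cong N monomial-zero) (valueAt1-constP N 1ℤ)
valueAt1-monomial (suc N) (suc k) (s≤s k≤N) = begin
  valueAt1 (suc N) (monomial (suc k))   ≡⟨ sum0-cong (suc N) (monomial-suc k) ⟩
  valueAt1 (suc N) (shiftP (monomial k)) ≡⟨ valueAt1-shiftP N (monomial k) ⟩
  valueAt1 N (monomial k)               ≡⟨ valueAt1-monomial N k k≤N ⟩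
  1ℤ                                    ∎

valueAt1-aigner-1 : ∀ N → valueAt1 (suc N) (aigner 1) ≡ 1ℤ
valueAt1-aigner-1 N = trans (valueAt1-X-*P N (powP Xm1 0)) (valueAt1-constP N 1ℤ)

valueAt1-aigner-≥2 : ∀ N k → 2 ≤ k → k ≤ N → valueAt1 N (aigner k) ≡ 0ℤ
valueAt1-aigner-≥2 (suc (suc N)) (suc (suc m)) (s≤s (s≤s _)) (s≤s (s≤s m≤N)) =
  begin
  valueAt1 (suc (suc N)) (X *P (Xm1 *P powP Xm1 m))
    ≡⟨ valueAt1-X-*P (suc N) _ ⟩
  valueAt1 (suc N) (Xm1 *P powP Xm1 m)
    ≡⟨ valueAt1-Xm1-*P N (powP Xm1 m) ⟩
  - powP Xm1 m (suc N)
    ≡⟨ cong -_ (powP-Xm1-above-degree m (suc N) (s≤s m≤N)) ⟩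
  0ℤ ∎

valueAt1-combination : ∀ N n (c : ℕ → ℤ) (P : ℕ → Poly) →
  valueAt1 N (sumP1 n (λ k → scale (c k) (P k))) ≡
  sum1 n (λ k → c k * valueAt1 N (P k))
valueAt1-combination N zero    c P = valueAt1-constP N 0ℤ
valueAt1-combination N (suc n) c P = begin
  valueAt1 N (sumP1 n Q +P Q (suc n))
    ≡⟨ sum0-+ N (sumP1 n Q) (Q (suc n)) ⟩
  valueAt1 N (sumP1 n Q) + valueAt1 N (Q (suc n))
    ≡⟨ cong₂ _+_ (valueAt1-combination N n c P)
                 (sum0-*ˡ N (c (suc n)) (P (suc n))) ⟩
  sum1 (suc n) (λ k → c k * valueAt1 N (P k)) ∎
  where Q = λ k → scale (c k) (P k)

valueAt1-monomial-combination : ∀ n (c : ℕ → ℤ) →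
  valueAt1 n (sumP1 n (λ k → scale (c k) (monomial k))) ≡ sum1 n c
valueAt1-monomial-combination n c =
  trans (valueAt1-combination n n c monomial) (sum1-cong n coeff)
  where
  coeff : ∀ {k} → 1 ≤ k → k ≤ n → c k * valueAt1 n (monomial k) ≡ c k
  coeff {k} _ k≤n =
    trans (cong (c k *_) (valueAt1-monomial n k k≤n)) (ℤ.*-identityʳ (c k))

valueAt1-aigner-combination : ∀ n (c : ℕ → ℤ) → 1 ≤ n →
  valueAt1 n (sumP1 n (λ k → scale (c k) (aigner k))) ≡ c 1
valueAt1-aigner-combination (suc n) c 1≤n = begin
  valueAt1 (suc n) (sumP1 (suc n) (λ k → scale (c k) (aigner k)))
    ≡⟨ valueAt1-combination (suc n) (suc n) c aigner ⟩
  sum1 (suc n) (λ k → c k * valueAt1 (suc n) (aigner k))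
    ≡⟨ sum1-first-only (suc n) _ 1≤n vanish ⟩
  c 1 * valueAt1 (suc n) (aigner 1)
    ≡⟨ trans (cong (c 1 *_) (valueAt1-aigner-1 n)) (ℤ.*-identityʳ (c 1)) ⟩
  c 1 ∎
  where
  vanish : ∀ {k} → 2 ≤ k → k ≤ suc n → c k * valueAt1 (suc n) (aigner k) ≡ 0ℤ
  vanish {k} 2≤k k≤n =
    trans (cong (c k *_) (valueAt1-aigner-≥2 (suc n) k 2≤k k≤n)) (ℤ.*-zeroʳ (c k))

mainTheorem5 : (Ω : SuccessionRule) → Standing Ω → (n : ℕ) → 1 ≤ n →
    (a : ℕ → ℤ) → beta Ω n ≈P sumP1 n (λ k → scale (a k) (aigner k)) →
    a 1 ≡ sum1 n (λ k → + eco Ω n k)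
mainTheorem5 Ω _ n 1≤n a β≈ = begin
  a 1
    ≡⟨ valueAt1-aigner-combination n a 1≤n ⟨
  valueAt1 n (sumP1 n (λ k → scale (a k) (aigner k)))
    ≡⟨ sum0-cong n β≈ ⟨
  valueAt1 n (beta Ω n)
    ≡⟨ valueAt1-monomial-combination n (λ k → + eco Ω n k) ⟩
  sum1 n (λ k → + eco Ω n k) ∎
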